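{- Let $\phi$ be a set composition of $[n]$ and $\psi$ a set composition with $\psi\le\phi$. Then for a set composition $\chi$ of $[n]$, we have $\psi\le\psi\wedge\chi\le\phi$ if and only if $\chi\le\xi$ for some $\xi\in\mathscr C_\phi^\psi$.
   Context: $[n]=\{1,\dots,n\}$. A set composition $\phi=\phi_1|\cdots|\phi_{\ell(\phi)}$ of $[n]$ is a sequence of pairwise disjoint nonempty sets with union $[n]$. For set compositions, $\psi\le\phi$ means each block of $\psi$ is a union of consecutive blocks of $\phi$. For $\psi=\psi_1|\cdots|\psi_{\ell(\psi)}$ and $\chi=\chi_1|\cdots|\chi_{\ell(\chi)}$, $\psi\wedge\chi$ is the set composition obtained from the sequence $\psi_1\cap\chi_1,\psi_1\cap\chi_2,\dots,\psi_1\cap\chi_{\ell(\chi)},\psi_2\cap\chi_1,\dots,\psi_{\ell(\psi)}\cap\chi_{\ell(\chi)}$ by deleting empty sets. $\mathscr C_\phi^\psi=\{\phi_{\tau(1)}|\phi_{\tau(2)}|\cdots|\phi_{\tau(\ell(\phi))}:\tau\in\mathfrak S_{\ell(\phi)},\ \psi\wedge(\phi_{\tau(1)}|\cdots|\phi_{\tau(\ell(\phi))})=\phi\}$. -}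

module Defs where

open import Data.Nat using (ℕ)
open import Data.Product using (Σ; ∃; _×_; _,_)
open import Data.List using (List; []; _∷_; map; concat; filter; cartesianProductWith)
open import Data.List.Relation.Unary.All using (All)
open import Data.List.Relation.Unary.AllPairs using (AllPairs)
open import Data.List.Relation.Binary.Permutation.Propositional using (_↭_)
open import Data.Fin.Subset using (Subset; Nonempty; Empty; _∩_; ⋃; ⊤)
open import Data.Fin.Subset.Properties using (nonempty?)
open import Relation.Binary.PropositionalEquality using (_≡_)

Blocks : ℕ → Set
Blocks n = List (Subset n)

IsSetComp : ∀ {n} → Blocks n → Set
IsSetComp φ = All Nonempty φ × AllPairs (λ p q → Empty (p ∩ q)) φ × ⋃ φ ≡ ⊤

NonEmptyList : ∀ {A : Set} → List A → Set
NonEmptyList [] = Data.Empty.⊥ where import Data.Empty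
NonEmptyList (_ ∷ _) = Data.Unit.⊤ where import Data.Unit

_≤ᶜ_ : ∀ {n} → Blocks n → Blocks n → Set
_≤ᶜ_ {n} ψ φ = Σ (List (Blocks n)) λ chunks →
  All NonEmptyList chunks × concat chunks ≡ φ × ψ ≡ map ⋃ chunks

_∧_ : ∀ {n} → Blocks n → Blocks n → Blocks n
ψ ∧ χ = filter nonempty? (cartesianProductWith _∩_ ψ χ)

InC : ∀ {n} → Blocks n → Blocks n → Blocks n → Set
InC φ ψ ξ = (ξ ↭ φ) × (ψ ∧ ξ ≡ φ)

-- Backward: a chunking χ ≤ ξ makes every block ψᵢ ∩ χⱼ of ψ ∧ χ the union of the
-- consecutive blocks ψᵢ ∩ ξₖ of ψ ∧ ξ = φ, and ψ ≤ ψ ∧ χ holds for any cover χ.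
-- Forward: if ψ ∧ χ ≤ φ, cut φ into a matrix whose entry (i, j) is the run of blocks
-- of φ with union ψᵢ ∩ χⱼ. Reading the matrix column by column gives a rearrangement
-- ξ of φ with χ ≤ ξ; since the blocks of row i lie in ψᵢ and are disjoint from every
-- other block of ψ, meeting ψᵢ with ξ recovers row i in order, so ψ ∧ ξ = φ.
module Submission where

open import Defs
open import Data.Nat using (ℕ; zero; suc; _⊓_)
open import Data.Nat.Properties using (⊓-idem; suc-injective)
open import Data.Product using (Σ; _×_; _,_)
open import Data.Unit using (tt)
open import Data.Empty using (⊥-elim)
open import Data.Sum using (inj₁; inj₂)
open import Function.Bundles using (_⇔_; mk⇔)
open import Data.List
  using (List; []; _∷_; map; concat; filter; _++_; zipWith; replicate; length)
open import Data.List.Properties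
  using ( map-++; filter-++; filter-accept; filter-reject; concat-++; ++-assoc
        ; ++-identityʳ; ∷-injective; length-map; length-replicate; length-zipWith)
open import Data.List.Relation.Unary.All as All using (All; []; _∷_)
open import Data.List.Relation.Unary.All.Properties using (++⁺; ++⁻ˡ; ++⁻ʳ; map⁻)
open import Data.List.Relation.Unary.AllPairs using (AllPairs; []; _∷_)
open import Data.List.Relation.Binary.Pointwise using (Pointwise; []; _∷_)
open import Data.List.Relation.Binary.Permutation.Propositional
  using (_↭_; ↭-refl; ↭-sym; ↭-trans; ↭-reflexive; module PermutationReasoning)
open import Data.List.Relation.Binary.Permutation.Propositional.Properties
  using (++⁺ˡ; shifts; All-resp-↭)
open import Data.Fin.Subset using (Subset; Nonempty; Empty; _∩_; _∪_; _⊆_; ⋃; ⊤; ⊥)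
open import Data.Fin.Subset.Properties
  using ( nonempty?; Empty-unique; ∉⊥; ⊆-trans; ⊆-reflexive; ⊆-antisym
        ; p⊆p∪q; q⊆p∪q; p∩q⊆p; p∩q⊆q; x∈p∩q⁺; x∈p∩q⁻; x∈p∪q⁻
        ; ∩-identityˡ; ∩-identityʳ; ∩-zeroˡ; ∩-zeroʳ; ∩-distribˡ-∪; ∩-distribʳ-∪
        ; ∪-identityˡ; ∪-assoc)
open import Relation.Nullary using (yes; no)
open import Relation.Binary.PropositionalEquality
  using (_≡_; refl; sym; trans; cong; cong₂; subst; subst₂; module ≡-Reasoning)

module _ {A : Set} where

  map-≡-++⁻ : ∀ {B : Set} (f : A → B) xs ys {zs} → map f xs ≡ ys ++ zs →
              Σ (List A) λ as → Σ (List A) λ bs →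
                xs ≡ as ++ bs × map f as ≡ ys × map f bs ≡ zs
  map-≡-++⁻ f xs       []       eq = [] , xs , refl , refl , eq
  map-≡-++⁻ f []       (y ∷ ys) ()
  map-≡-++⁻ f (x ∷ xs) (y ∷ ys) eq
    with fx≡y , rest ← ∷-injective eq
    with as , bs , xs≡ , as↦ , bs↦ ← map-≡-++⁻ f xs ys rest
    = x ∷ as , bs , cong (x ∷_) xs≡ , cong₂ _∷_ fx≡y as↦ , bs↦

  concat-zipWith-++ : ∀ (xss yss : List (List A)) → length xss ≡ length yss →
                      concat (zipWith _++_ xss yss) ↭ concat xss ++ concat yss
  concat-zipWith-++ []         []         _  = ↭-refl
  concat-zipWith-++ (xs ∷ xss) (ys ∷ yss) eq = begin
    (xs ++ ys) ++ concat (zipWith _++_ xss yss) ↭⟨ ++⁺ˡ (xs ++ ys) (concat-zipWith-++ xss yss (suc-injective eq)) ⟩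
    (xs ++ ys) ++ concat xss ++ concat yss      ≡⟨ ++-assoc xs ys _ ⟩
    xs ++ ys ++ concat xss ++ concat yss        ↭⟨ ++⁺ˡ xs (shifts ys (concat xss)) ⟩
    xs ++ concat xss ++ ys ++ concat yss        ≡⟨ ++-assoc xs (concat xss) _ ⟨
    (xs ++ concat xss) ++ ys ++ concat yss      ∎
    where open PermutationReasoning

  -- Column j concatenates the j-th entries of the rows; the width m matters only when there are no rows.
  columns : ℕ → List (List (List A)) → List (List A)
  columns m []      = replicate m []
  columns m (r ∷ M) = zipWith _++_ r (columns m M)

  length-columns : ∀ {m} M → All (λ r → length r ≡ m) M → length (columns m M) ≡ m
  length-columns {m} []      []          = length-replicate m
  length-columns {m} (r ∷ M) (|r| ∷ |M|) = begin
    length (zipWith _++_ r (columns m M))        ≡⟨ length-zipWith _++_ r _ ⟩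
    length r ⊓ length (columns m M)              ≡⟨ cong₂ _⊓_ |r| (length-columns M |M|) ⟩
    m ⊓ m                                        ≡⟨ ⊓-idem m ⟩
    m                                            ∎
    where open ≡-Reasoning

  concat-columns-↭ : ∀ {m} M → All (λ r → length r ≡ m) M →
                     concat (columns m M) ↭ concat (map concat M)
  concat-columns-↭ {m} []      []          = ↭-reflexive (concat-replicate-[] m)
    where
    concat-replicate-[] : ∀ k → concat (replicate k ([] {A = A})) ≡ []
    concat-replicate-[] zero    = refl
    concat-replicate-[] (suc k) = concat-replicate-[] k
  concat-columns-↭ {m} (r ∷ M) (|r| ∷ |M|) =
    ↭-trans (concat-zipWith-++ r (columns m M) (trans |r| (sym (length-columns M |M|))))
            (++⁺ˡ (concat r) (concat-columns-↭ M |M|))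

module _ {n : ℕ} where

  Disjoint : Subset n → Subset n → Set
  Disjoint p q = Empty (p ∩ q)

  Disjoint-sym : {p q : Subset n} → Disjoint p q → Disjoint q p
  Disjoint-sym p#q (x , x∈q∩p) with x∈q , x∈p ← x∈p∩q⁻ _ _ x∈q∩p = p#q (x , x∈p∩q⁺ (x∈p , x∈q))

  Disjoint-⊆ʳ : {p q b : Subset n} → Disjoint p q → b ⊆ q → Disjoint p b
  Disjoint-⊆ʳ p#q b⊆q (x , x∈p∩b) with x∈p , x∈b ← x∈p∩q⁻ _ _ x∈p∩b = p#q (x , x∈p∩q⁺ (x∈p , b⊆q x∈b))

  ⊆⇒∩≡ : {p b : Subset n} → b ⊆ p → p ∩ b ≡ b
  ⊆⇒∩≡ {p} {b} b⊆p = ⊆-antisym (p∩q⊆q p b) (λ x∈b → x∈p∩q⁺ (b⊆p x∈b , x∈b))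

  ⋃-++ : ∀ (xs ys : Blocks n) → ⋃ (xs ++ ys) ≡ ⋃ xs ∪ ⋃ ys
  ⋃-++ []       ys = sym (∪-identityˡ _)
  ⋃-++ (x ∷ xs) ys = trans (cong (x ∪_) (⋃-++ xs ys)) (sym (∪-assoc x _ _))

  ⋃-filter-nonempty : ∀ (xs : Blocks n) → ⋃ (filter nonempty? xs) ≡ ⋃ xs
  ⋃-filter-nonempty []       = refl
  ⋃-filter-nonempty (x ∷ xs) with nonempty? x
  ... | yes _       = cong (x ∪_) (⋃-filter-nonempty xs)
  ... | no x-empty = trans (⋃-filter-nonempty xs)
                           (sym (trans (cong (_∪ ⋃ xs) (Empty-unique x-empty)) (∪-identityˡ _)))

  ⋃-map-∩ : ∀ p (xs : Blocks n) → ⋃ (map (p ∩_) xs) ≡ p ∩ ⋃ xs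
  ⋃-map-∩ p []       = sym (∩-zeroʳ p)
  ⋃-map-∩ p (x ∷ xs) = trans (cong (p ∩ x ∪_) (⋃-map-∩ p xs)) (sym (∩-distribˡ-∪ p x (⋃ xs)))

  All⊆-trans : ∀ {p q} {xs : Blocks n} → All (_⊆ p) xs → p ⊆ q → All (_⊆ q) xs
  All⊆-trans []             p⊆q = []
  All⊆-trans (x⊆p ∷ xs⊆p) p⊆q = (λ x∈ → p⊆q (x⊆p x∈)) ∷ All⊆-trans xs⊆p p⊆q

  ⊆-⋃ : ∀ (xs : Blocks n) → All (_⊆ ⋃ xs) xs
  ⊆-⋃ []       = []
  ⊆-⋃ (x ∷ xs) = p⊆p∪q (⋃ xs) ∷ All⊆-trans (⊆-⋃ xs) (q⊆p∪q x (⋃ xs))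

  Disjoint-⋃ : ∀ {p} {qs : Blocks n} → All (Disjoint p) qs → Disjoint p (⋃ qs)
  Disjoint-⋃ {p} []           (x , x∈p∩⊥) with _ , x∈⊥ ← x∈p∩q⁻ p ⊥ x∈p∩⊥ = ∉⊥ x∈⊥
  Disjoint-⋃ {p} {q ∷ qs} (p#q ∷ p#qs) (x , x∈p∩⋃) with x∈p∩q⁻ p _ x∈p∩⋃
  ... | x∈p , x∈⋃ with x∈p∪q⁻ q (⋃ qs) x∈⋃
  ...   | inj₁ x∈q   = p#q (x , x∈p∩q⁺ (x∈p , x∈q))
  ...   | inj₂ x∈⋃qs = Disjoint-⋃ p#qs (x , x∈p∩q⁺ (x∈p , x∈⋃qs))

  Nonempty-⋃⇒NonEmptyList : ∀ {xs : Blocks n} → Nonempty (⋃ xs) → NonEmptyList xs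
  Nonempty-⋃⇒NonEmptyList {[]}    (_ , x∈⊥) = ⊥-elim (∉⊥ x∈⊥)
  Nonempty-⋃⇒NonEmptyList {_ ∷ _} _         = tt

  restrict : Subset n → Blocks n → Blocks n
  restrict p xs = filter nonempty? (map (p ∩_) xs)

  restrict-++ : ∀ p (xs ys : Blocks n) → restrict p (xs ++ ys) ≡ restrict p xs ++ restrict p ys
  restrict-++ p xs ys =
    trans (cong (filter nonempty?) (map-++ (p ∩_) xs ys)) (filter-++ nonempty? (map (p ∩_) xs) _)

  ∧-∷ : ∀ p (ψ χ : Blocks n) → (p ∷ ψ) ∧ χ ≡ restrict p χ ++ ψ ∧ χ
  ∧-∷ p ψ χ = filter-++ nonempty? (map (p ∩_) χ) _

  ⋃-restrict : ∀ p (xs : Blocks n) → ⋃ (restrict p xs) ≡ p ∩ ⋃ xs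
  ⋃-restrict p xs = trans (⋃-filter-nonempty (map (p ∩_) xs)) (⋃-map-∩ p xs)

  restrict-⊆ : ∀ {p} {xs : Blocks n} → All (_⊆ p) xs → All Nonempty xs → restrict p xs ≡ xs
  restrict-⊆ []             []           = refl
  restrict-⊆ (x⊆p ∷ xs⊆p) (x≢∅ ∷ xs≢∅) =
    trans (filter-accept nonempty? (subst Nonempty (sym (⊆⇒∩≡ x⊆p)) x≢∅))
          (cong₂ _∷_ (⊆⇒∩≡ x⊆p) (restrict-⊆ xs⊆p xs≢∅))

  restrict-Disjoint : ∀ {p} {xs : Blocks n} → All (Disjoint p) xs → restrict p xs ≡ []
  restrict-Disjoint []             = refl
  restrict-Disjoint (p#x ∷ p#xs) = trans (filter-reject nonempty? p#x) (restrict-Disjoint p#xs)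

  ≤ᶜ-[] : _≤ᶜ_ {n} [] []
  ≤ᶜ-[] = [] , [] , refl , refl

  ≤ᶜ-∷ : ∀ {g a b : Blocks n} → NonEmptyList g → a ≤ᶜ b → (⋃ g ∷ a) ≤ᶜ (g ++ b)
  ≤ᶜ-∷ {g} g≢[] (C , C≢[] , concatC , a≡) = g ∷ C , g≢[] ∷ C≢[] , cong (g ++_) concatC , cong (⋃ g ∷_) a≡

  ≤ᶜ-++ : ∀ {a b a′ b′ : Blocks n} → a ≤ᶜ b → a′ ≤ᶜ b′ → (a ++ a′) ≤ᶜ (b ++ b′)
  ≤ᶜ-++ (C , C≢[] , concatC , a≡) (C′ , C′≢[] , concatC′ , a′≡) =
    C ++ C′ , ++⁺ C≢[] C′≢[] ,
    trans (sym (concat-++ C C′)) (cong₂ _++_ concatC concatC′) ,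
    trans (cong₂ _++_ a≡ a′≡) (sym (map-++ ⋃ C C′))

  ≤ᶜ-∧ : ∀ (ψ χ : Blocks n) → All Nonempty ψ → ⋃ χ ≡ ⊤ → ψ ≤ᶜ (ψ ∧ χ)
  ≤ᶜ-∧ []      χ []          ⋃χ≡⊤ = ≤ᶜ-[]
  ≤ᶜ-∧ (p ∷ ψ) χ (p≢∅ ∷ ψ≢∅) ⋃χ≡⊤ =
    subst₂ _≤ᶜ_ (cong (_∷ ψ) ⋃row≡p) (sym (∧-∷ p ψ χ))
           (≤ᶜ-∷ (Nonempty-⋃⇒NonEmptyList (subst Nonempty (sym ⋃row≡p) p≢∅)) (≤ᶜ-∧ ψ χ ψ≢∅ ⋃χ≡⊤))
    where
    ⋃row≡p : ⋃ (restrict p χ) ≡ p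
    ⋃row≡p = trans (⋃-restrict p χ) (trans (cong (p ∩_) ⋃χ≡⊤) (∩-identityʳ p))

  restrict-map-⋃-≤ᶜ : ∀ p (D : List (Blocks n)) → restrict p (map ⋃ D) ≤ᶜ restrict p (concat D)
  restrict-map-⋃-≤ᶜ p []      = ≤ᶜ-[]
  restrict-map-⋃-≤ᶜ p (d ∷ D) with nonempty? (p ∩ ⋃ d)
  ... | yes p∩d≢∅ =
    subst₂ _≤ᶜ_ (cong (_∷ restrict p (map ⋃ D)) (⋃-restrict p d)) (sym (restrict-++ p d (concat D)))
           (≤ᶜ-∷ (Nonempty-⋃⇒NonEmptyList (subst Nonempty (sym (⋃-restrict p d)) p∩d≢∅))
                 (restrict-map-⋃-≤ᶜ p D))
  ... | no p#d =
    subst (_ ≤ᶜ_) (sym (trans (restrict-++ p d (concat D)) (cong (_++ restrict p (concat D)) row≡[])))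
          (restrict-map-⋃-≤ᶜ p D)
    where
    row≡[] : restrict p d ≡ []
    row≡[] = restrict-Disjoint (All.map (Disjoint-⊆ʳ p#d) (⊆-⋃ d))

  ∧-monoʳ-≤ᶜ : ∀ (ψ : Blocks n) {χ ξ} → χ ≤ᶜ ξ → (ψ ∧ χ) ≤ᶜ (ψ ∧ ξ)
  ∧-monoʳ-≤ᶜ []      _                        = ≤ᶜ-[]
  ∧-monoʳ-≤ᶜ (p ∷ ψ) χ≤ξ@(D , _ , refl , refl) =
    subst₂ _≤ᶜ_ (sym (∧-∷ p ψ (map ⋃ D))) (sym (∧-∷ p ψ (concat D)))
           (≤ᶜ-++ (restrict-map-⋃-≤ᶜ p D) (∧-monoʳ-≤ᶜ ψ χ≤ξ))

  -- Reinsert an empty chunk for each empty set deleted by the filter.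
  unfilter-chunks : ∀ (ys : Blocks n) (E : List (Blocks n)) → filter nonempty? ys ≡ map ⋃ E →
                    Σ (List (Blocks n)) λ E′ → map ⋃ E′ ≡ ys × concat E′ ≡ concat E
  unfilter-chunks []       []      _  = [] , refl , refl
  unfilter-chunks (y ∷ ys) E       eq with nonempty? y
  unfilter-chunks (y ∷ ys) (e ∷ E) eq | yes _
    with y≡ , rest ← ∷-injective eq
    with E′ , E′↦ys , concatE′ ← unfilter-chunks ys E rest
    = e ∷ E′ , cong₂ _∷_ (sym y≡) E′↦ys , cong (e ++_) concatE′
  unfilter-chunks (y ∷ ys) E       eq | no y-empty
    with E′ , E′↦ys , concatE′ ← unfilter-chunks ys E eq
    = [] ∷ E′ , cong₂ _∷_ (sym (Empty-unique y-empty)) E′↦ys , concatE′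

  IsMeetRow : Blocks n → Subset n → List (Blocks n) → Set
  IsMeetRow χ p r = map ⋃ r ≡ map (p ∩_) χ

  IsMeetMatrix : Blocks n → Blocks n → List (List (Blocks n)) → Set
  IsMeetMatrix χ ψ M = Pointwise (IsMeetRow χ) ψ M

  meetMatrix : ∀ (ψ χ : Blocks n) E → ψ ∧ χ ≡ map ⋃ E →
               Σ (List (List (Blocks n))) λ M → IsMeetMatrix χ ψ M × concat (map concat M) ≡ concat E
  meetMatrix []      χ []      _  = [] , [] , refl
  meetMatrix (p ∷ ψ) χ E       eq
    with as , bs , E≡ , as↦ , bs↦ ← map-≡-++⁻ ⋃ E (restrict p χ) (trans (sym eq) (∧-∷ p ψ χ))
    with r , r↦ , concat-r ← unfilter-chunks (map (p ∩_) χ) as (sym as↦)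
    with M , matrix , concat-M ← meetMatrix ψ χ bs (sym bs↦)
    = r ∷ M , r↦ ∷ matrix , (begin
        concat r ++ concat (map concat M) ≡⟨ cong₂ _++_ concat-r concat-M ⟩
        concat as ++ concat bs            ≡⟨ concat-++ as bs ⟩
        concat (as ++ bs)                 ≡⟨ cong concat E≡ ⟨
        concat E                          ∎)
    where open ≡-Reasoning

  meetRow-length : ∀ {χ p} {r : List (Blocks n)} → IsMeetRow χ p r → length r ≡ length χ
  meetRow-length {χ} {p} {r} r↦ = trans (sym (length-map ⋃ r)) (trans (cong length r↦) (length-map (p ∩_) χ))

  meetRow-⊆ : ∀ {χ p} (r : List (Blocks n)) → IsMeetRow χ p r → All (_⊆ p) (concat r)
  meetRow-⊆ []      _ = []
  meetRow-⊆ {c ∷ χ} {p} (a ∷ r) a∷r↦ with ⋃a≡ , r↦ ← ∷-injective a∷r↦ =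
    ++⁺ (All⊆-trans (⊆-⋃ a) (⊆-trans (⊆-reflexive ⋃a≡) (p∩q⊆p p c))) (meetRow-⊆ r r↦)

  meetMatrix-rowLengths : ∀ {χ ψ M} → IsMeetMatrix χ ψ M → All (λ r → length r ≡ length χ) M
  meetMatrix-rowLengths []              = []
  meetMatrix-rowLengths (r↦ ∷ matrix) = meetRow-length r↦ ∷ meetMatrix-rowLengths matrix

  meetMatrix-⊆-⋃ : ∀ {χ ψ M} → IsMeetMatrix χ ψ M → All (_⊆ ⋃ ψ) (concat (map concat M))
  meetMatrix-⊆-⋃ []                                  = []
  meetMatrix-⊆-⋃ {ψ = p ∷ ψ} {r ∷ M} (r↦ ∷ matrix) =
    ++⁺ (All⊆-trans (meetRow-⊆ r r↦) (p⊆p∪q (⋃ ψ))) (All⊆-trans (meetMatrix-⊆-⋃ matrix) (q⊆p∪q p (⋃ ψ)))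

  map-⋃-zipWith-++ : ∀ (xss yss : List (Blocks n)) →
                     map ⋃ (zipWith _++_ xss yss) ≡ zipWith _∪_ (map ⋃ xss) (map ⋃ yss)
  map-⋃-zipWith-++ []         yss        = refl
  map-⋃-zipWith-++ (xs ∷ xss) []         = refl
  map-⋃-zipWith-++ (xs ∷ xss) (ys ∷ yss) = cong₂ _∷_ (⋃-++ xs ys) (map-⋃-zipWith-++ xss yss)

  map-⋃-columns : ∀ {χ ψ M} → IsMeetMatrix χ ψ M → map ⋃ (columns (length χ) M) ≡ map (⋃ ψ ∩_) χ
  map-⋃-columns {χ} []                              = empty-columns χ
    where
    empty-columns : ∀ (χ : Blocks n) → map ⋃ (replicate (length χ) []) ≡ map (⊥ ∩_) χ
    empty-columns []      = refl
    empty-columns (c ∷ χ) = cong₂ _∷_ (sym (∩-zeroˡ c)) (empty-columns χ)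
  map-⋃-columns {χ} {p ∷ ψ} {r ∷ M} (r↦ ∷ matrix) = begin
    map ⋃ (zipWith _++_ r (columns (length χ) M))              ≡⟨ map-⋃-zipWith-++ r _ ⟩
    zipWith _∪_ (map ⋃ r) (map ⋃ (columns (length χ) M))     ≡⟨ cong₂ (zipWith _∪_) r↦ (map-⋃-columns matrix) ⟩
    zipWith _∪_ (map (p ∩_) χ) (map (⋃ ψ ∩_) χ)              ≡⟨ zipWith-∪-∩ χ ⟩
    map ((p ∪ ⋃ ψ) ∩_) χ                                      ∎
    where
    open ≡-Reasoning
    zipWith-∪-∩ : ∀ (χ : Blocks n) → zipWith _∪_ (map (p ∩_) χ) (map (⋃ ψ ∩_) χ) ≡ map ((p ∪ ⋃ ψ) ∩_) χ
    zipWith-∪-∩ []      = refl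
    zipWith-∪-∩ (c ∷ χ) = cong₂ _∷_ (sym (∩-distribʳ-∪ c p (⋃ ψ))) (zipWith-∪-∩ χ)

  restrict-zipWith-++-⊆ : ∀ {p} (r Ds : List (Blocks n)) → length r ≡ length Ds →
                          All (_⊆ p) (concat r) → All Nonempty (concat r) → All (Disjoint p) (concat Ds) →
                          restrict p (concat (zipWith _++_ r Ds)) ≡ concat r
  restrict-zipWith-++-⊆         []      []       _  _  _   _   = refl
  restrict-zipWith-++-⊆ {p} (a ∷ r) (d ∷ Ds) eq r⊆ r≢∅ Ds# = begin
    restrict p ((a ++ d) ++ concat (zipWith _++_ r Ds))
      ≡⟨ restrict-++ p (a ++ d) _ ⟩
    restrict p (a ++ d) ++ restrict p (concat (zipWith _++_ r Ds))
      ≡⟨ cong₂ _++_ (restrict-++ p a d)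
                    (restrict-zipWith-++-⊆ r Ds (suc-injective eq) (++⁻ʳ a r⊆) (++⁻ʳ a r≢∅) (++⁻ʳ d Ds#)) ⟩
    (restrict p a ++ restrict p d) ++ concat r
      ≡⟨ cong₂ (λ x y → (x ++ y) ++ concat r) (restrict-⊆ (++⁻ˡ a r⊆) (++⁻ˡ a r≢∅)) (restrict-Disjoint (++⁻ˡ d Ds#)) ⟩
    (a ++ []) ++ concat r
      ≡⟨ cong (_++ concat r) (++-identityʳ a) ⟩
    a ++ concat r
      ∎
    where open ≡-Reasoning

  restrict-zipWith-++-Disjoint : ∀ {q} (r Ds : List (Blocks n)) → length r ≡ length Ds →
                                 All (Disjoint q) (concat r) →
                                 restrict q (concat (zipWith _++_ r Ds)) ≡ restrict q (concat Ds)
  restrict-zipWith-++-Disjoint         []      []       _  _   = refl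
  restrict-zipWith-++-Disjoint {q} (a ∷ r) (d ∷ Ds) eq r# = begin
    restrict q ((a ++ d) ++ concat (zipWith _++_ r Ds))
      ≡⟨ restrict-++ q (a ++ d) _ ⟩
    restrict q (a ++ d) ++ restrict q (concat (zipWith _++_ r Ds))
      ≡⟨ cong₂ _++_ (trans (restrict-++ q a d) (cong (_++ restrict q d) (restrict-Disjoint (++⁻ˡ a r#))))
                    (restrict-zipWith-++-Disjoint r Ds (suc-injective eq) (++⁻ʳ a r#)) ⟩
    restrict q d ++ restrict q (concat Ds)
      ≡⟨ restrict-++ q d (concat Ds) ⟨
    restrict q (d ++ concat Ds)
      ∎
    where open ≡-Reasoning

  ∧-zipWith-++-Disjoint : ∀ (ψ : Blocks n) r Ds → length r ≡ length Ds →
                          All (λ q → All (Disjoint q) (concat r)) ψ →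
                          ψ ∧ concat (zipWith _++_ r Ds) ≡ ψ ∧ concat Ds
  ∧-zipWith-++-Disjoint []      r Ds eq []         = refl
  ∧-zipWith-++-Disjoint (q ∷ ψ) r Ds eq (q#r ∷ ψ#r) =
    trans (∧-∷ q ψ _)
          (trans (cong₂ _++_ (restrict-zipWith-++-Disjoint r Ds eq q#r) (∧-zipWith-++-Disjoint ψ r Ds eq ψ#r))
                 (sym (∧-∷ q ψ _)))

  ∧-columns : ∀ {χ ψ M} → AllPairs Disjoint ψ → IsMeetMatrix χ ψ M → All Nonempty (concat (map concat M)) →
              ψ ∧ concat (columns (length χ) M) ≡ concat (map concat M)
  ∧-columns             []           []              _    = refl
  ∧-columns {χ} {p ∷ ψ} {r ∷ M} (p#ψ ∷ ψ#) (r↦ ∷ matrix) M≢∅ = begin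
    (p ∷ ψ) ∧ concat (zipWith _++_ r Ds)
      ≡⟨ ∧-∷ p ψ _ ⟩
    restrict p (concat (zipWith _++_ r Ds)) ++ ψ ∧ concat (zipWith _++_ r Ds)
      ≡⟨ cong₂ _++_ (restrict-zipWith-++-⊆ r Ds |r|≡|Ds| r⊆p (++⁻ˡ (concat r) M≢∅) p#Ds)
                    (∧-zipWith-++-Disjoint ψ r Ds |r|≡|Ds| ψ#r) ⟩
    concat r ++ ψ ∧ concat Ds
      ≡⟨ cong (concat r ++_) (∧-columns ψ# matrix (++⁻ʳ (concat r) M≢∅)) ⟩
    concat r ++ concat (map concat M)
      ∎
    where
    open ≡-Reasoning
    Ds = columns (length χ) M
    |M| = meetMatrix-rowLengths matrix
    |r|≡|Ds| : length r ≡ length Ds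
    |r|≡|Ds| = trans (meetRow-length r↦) (sym (length-columns M |M|))
    r⊆p : All (_⊆ p) (concat r)
    r⊆p = meetRow-⊆ r r↦
    p#Ds : All (Disjoint p) (concat Ds)
    p#Ds = All.map (Disjoint-⊆ʳ (Disjoint-⋃ p#ψ))
                   (All-resp-↭ (↭-sym (concat-columns-↭ M |M|)) (meetMatrix-⊆-⋃ matrix))
    ψ#r : All (λ q → All (Disjoint q) (concat r)) ψ
    ψ#r = All.map (λ p#q → All.map (Disjoint-⊆ʳ (Disjoint-sym p#q)) r⊆p) p#ψ

  ∧-≤ᶜ⇒∃C : ∀ {φ ψ χ : Blocks n} → All Nonempty φ → AllPairs Disjoint ψ → ⋃ ψ ≡ ⊤ → All Nonempty χ →
            (ψ ∧ χ) ≤ᶜ φ → Σ (Blocks n) λ ξ → InC φ ψ ξ × χ ≤ᶜ ξ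
  ∧-≤ᶜ⇒∃C {φ} {ψ} {χ} φ≢∅ ψ# ⋃ψ≡⊤ χ≢∅ (E , _ , concatE , ψ∧χ↦E)
    with M , matrix , concat-M ← meetMatrix ψ χ E ψ∧χ↦E
    = concat Ds , (ξ↭φ , ψ∧ξ≡φ) , (Ds , Ds≢[] , refl , χ≡)
    where
    Ds = columns (length χ) M
    M≡φ : concat (map concat M) ≡ φ
    M≡φ = trans concat-M concatE
    ξ↭φ : concat Ds ↭ φ
    ξ↭φ = subst (concat Ds ↭_) M≡φ (concat-columns-↭ M (meetMatrix-rowLengths matrix))
    ψ∧ξ≡φ : ψ ∧ concat Ds ≡ φ
    ψ∧ξ≡φ = trans (∧-columns ψ# matrix (subst (All Nonempty) (sym M≡φ) φ≢∅)) M≡φ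
    χ≡ : χ ≡ map ⋃ Ds
    χ≡ = sym (trans (map-⋃-columns matrix) (trans (cong (λ u → map (u ∩_) χ) ⋃ψ≡⊤) (map-⊤∩ χ)))
      where
      map-⊤∩ : ∀ (χ : Blocks n) → map (⊤ ∩_) χ ≡ χ
      map-⊤∩ []      = refl
      map-⊤∩ (c ∷ χ) = cong₂ _∷_ (∩-identityˡ c) (map-⊤∩ χ)
    Ds≢[] : All NonEmptyList Ds
    Ds≢[] = All.map Nonempty-⋃⇒NonEmptyList (map⁻ (subst (All Nonempty) χ≡ χ≢∅))

proposition11p4 : (n : ℕ) (φ ψ χ : Blocks n) →
    IsSetComp φ → IsSetComp ψ → ψ ≤ᶜ φ → IsSetComp χ →
    ((ψ ≤ᶜ (ψ ∧ χ)) × ((ψ ∧ χ) ≤ᶜ φ)) ⇔ Σ (Blocks n) (λ ξ → InC φ ψ ξ × χ ≤ᶜ ξ)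
proposition11p4 n φ ψ χ (φ≢∅ , _ , _) (ψ≢∅ , ψ# , ⋃ψ≡⊤) _ (χ≢∅ , _ , ⋃χ≡⊤) = mk⇔
  (λ (_ , ψ∧χ≤φ) → ∧-≤ᶜ⇒∃C φ≢∅ ψ# ⋃ψ≡⊤ χ≢∅ ψ∧χ≤φ)
  (λ (_ , (_ , ψ∧ξ≡φ) , χ≤ξ) → ≤ᶜ-∧ ψ χ ψ≢∅ ⋃χ≡⊤ , subst ((ψ ∧ χ) ≤ᶜ_) ψ∧ξ≡φ (∧-monoʳ-≤ᶜ ψ χ≤ξ))
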